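{- Let $n\geq 1$ and $k\in\mathbb{N}$, let $f:[\mathbb{N}]^n\rightarrow\{1,\dots,k\}$ be computable and $\phi:\mathbb{N}\rightarrow\mathbb{N}$ computable with $w\rightarrow(\phi(w))^n_{k+1}$ for all $w$ and $\liminf_w\phi(w)=\infty$. Suppose $L\subseteq[\mathbb{N}]^{n-1}$ is large and $p\leq n-1$. Then for any coloring $h:[\mathbb{N}]^p\rightarrow\{1,\dots,s\}$, the set $\{Z\in L: Z \text{ is } h\text{ -homogeneous}\}$ is large.
   Context: $[X]^j$ is the set of $j$-element subsets of $X$; $Z$ is $h$-homogeneous if $h$ is constant on $[Z]^p$. $w\rightarrow(m)^n_j$ means every $j$-coloring of $[X]^n$ for a $w$-element set $X$ has a subset of size $m$ on whose $n$-element subsets the coloring is constant. Let $\ell=2^{n-1}-1$, enumerate the tuples $(r_1,\dots,r_j)$ of positive integers with $r_1+\dots+r_j=n$ and $j>1$ as $t_1,\dots,t_\ell$, and let $a_i$ be the first component of $t_i$. For $\rho:[\{1,\dots,w\}]^{a}\rightarrow\{1,\dots,q\}$, $Y\subseteq\{1,\dots,w\}$ is homogeneous for $\rho$ if $\rho$ is constant on $[Y]^a$. A set $L\subseteq[\mathbb{N}]^{n-1}$ is large (with respect to $f,\phi$) if for all $m,p_1,\dots,p_\ell\in\mathbb{N}$ there is $w$ such that for all $\rho_1,\dots,\rho_\ell$ with $\rho_i:[\{1,\dots,w\}]^{a_i}\rightarrow\{1,\dots,p_i\}$ there is $Y\subseteq(m,w]$ with $[Y]^{n-1}\subseteq L$,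 $|Y|\geq\phi(w)$, $Y$ homogeneous for $f$, and $Y$ homogeneous for each $\rho_i$. -}

module Defs where

open import Data.Nat using (ℕ; zero; suc; _≤_; _<_; _∸_)
open import Data.Fin using (Fin)
open import Data.List using (List; []; _∷_; length)
open import Data.Nat.ListAction using (sum)
open import Data.List.Relation.Unary.All using (All)
open import Data.List.Relation.Unary.Linked using (Linked)
open import Data.List.Relation.Binary.Sublist.Propositional using (_⊆_)
open import Data.Product using (Σ; ∃; _×_; _,_; proj₁)
open import Relation.Binary.PropositionalEquality using (_≡_)

-- A finite subset of ℕ is represented by the strictly increasing list of its
-- elements.  For such a Y, the j-element subsets of Y ([Y]^j) are exactly the
-- sublists Z ⊆ Y with length Z ≡ j (again strictly increasing lists).
Sorted : List ℕ → Set
Sorted = Linked _<_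

-- A colouring of [ℕ]^j with c colours {1,…,c} is modelled as a function
-- List ℕ → Fin c; only its values on strictly increasing lists of length j
-- matter (every colouring of [ℕ]^j extends to such a function).

Homog : {C : Set} → ℕ → (List ℕ → C) → List ℕ → Set
Homog j col Z = ∀ (A B : List ℕ) → A ⊆ Z → B ⊆ Z →
  length A ≡ j → length B ≡ j → col A ≡ col B

Arrow : ℕ → ℕ → ℕ → ℕ → Set
Arrow w m n j = ∀ (X : List ℕ) → Sorted X → length X ≡ w →
  ∀ (c : List ℕ → Fin j) →
  Σ (List ℕ) λ Y → Y ⊆ X × length Y ≡ m × Homog n c Y

LiminfInfinite : (ℕ → ℕ) → Set
LiminfInfinite φ = ∀ (M : ℕ) → Σ ℕ λ N → ∀ w → N ≤ w → M ≤ φ w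

-- Tuples (r₁,…,r_j) of positive integers with r₁+⋯+r_j = n and j > 1.
-- (There are exactly ℓ = 2^(n-1) - 1 of them; they index p_i and ρ_i.)
Comp : ℕ → Set
Comp n = Σ (List ℕ) λ t → All (λ r → 1 ≤ r) t × sum t ≡ n × 2 ≤ length t

first : List ℕ → ℕ
first [] = 0
first (r ∷ _) = r

firstC : {n : ℕ} → Comp n → ℕ
firstC t = first (proj₁ t)

Large : (n : ℕ) {k : ℕ} → (List ℕ → Fin k) → (ℕ → ℕ) → (List ℕ → Set) → Set
Large n f φ L =
  ∀ (m : ℕ) (p : Comp n → ℕ) → Σ ℕ λ w →
  ∀ (ρ : (t : Comp n) → List ℕ → Fin (p t)) →
  Σ (List ℕ) λ Y →
    Sorted Y × All (λ y → m < y × y ≤ w) Y ×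
    (∀ Z → Z ⊆ Y → length Z ≡ n ∸ 1 → L Z) ×
    φ w ≤ length Y ×
    Homog n f Y ×
    (∀ (t : Comp n) → Homog (firstC t) (ρ t) Y)

module Submission where

-- Enlarge every palette p_t by a factor s and refine each ρ_t by h.  A set Y
-- that largeness provides for the refined colourings is homogeneous for every
-- ρ_t and, through a composition whose first part is p, for h on p-sets; the
-- latter is inherited by every (n-1)-subset Z of Y.  For p = 0 there is only
-- one 0-set, so every Z is h-homogeneous.

open import Defs
open import Data.Nat using (ℕ; zero; suc; _≤_; _<_; _∸_; _*_; _+_; z≤n; s≤s)
open import Data.Nat.Properties using (m+[n∸m]≡n; +-identityʳ; m<n⇒0<n∸m; <⇒≤)
open import Data.Fin using (Fin; combine)
open import Data.Fin.Properties using (combine-injectiveˡ; combine-injectiveʳ)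
open import Data.List using (List; []; _∷_; length)
open import Data.List.Relation.Unary.All using (All; []; _∷_)
open import Data.List.Relation.Binary.Sublist.Propositional using (_⊆_; ⊆-trans)
open import Data.Product using (_×_; _,_)
open import Relation.Binary.PropositionalEquality using (_≡_; refl; cong; trans; sym)

length≡0⇒≡[] : {A : List ℕ} → length A ≡ 0 → A ≡ []
length≡0⇒≡[] {[]} _ = refl

Homog-zero : {C : Set} (c : List ℕ → C) (Z : List ℕ) → Homog 0 c Z
Homog-zero c Z A B _ _ lenA lenB =
  cong c (trans (length≡0⇒≡[] lenA) (sym (length≡0⇒≡[] lenB)))

Homog-⊆ : {C : Set} {j : ℕ} {c : List ℕ → C} {Y Z : List ℕ} →
  Z ⊆ Y → Homog j c Y → Homog j c Z
Homog-⊆ Z⊆Y hom A B A⊆Z B⊆Z = hom A B (⊆-trans A⊆Z Z⊆Y) (⊆-trans B⊆Z Z⊆Y)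

module _ {a b j : ℕ} {c : List ℕ → Fin a} {d : List ℕ → Fin b} {Y : List ℕ}
         (hom : Homog j (λ A → combine (c A) (d A)) Y) where

  Homog-combineˡ : Homog j c Y
  Homog-combineˡ A B A⊆Y B⊆Y lenA lenB =
    combine-injectiveˡ (c A) (d A) (c B) (d B) (hom A B A⊆Y B⊆Y lenA lenB)

  Homog-combineʳ : Homog j d Y
  Homog-combineʳ A B A⊆Y B⊆Y lenA lenB =
    combine-injectiveʳ (c A) (d A) (c B) (d B) (hom A B A⊆Y B⊆Y lenA lenB)

twoPartComp : (n p : ℕ) → 1 ≤ p → p < n → Comp n
twoPartComp n p 1≤p p<n =
  (p ∷ (n ∸ p) ∷ []) ,
  (1≤p ∷ m<n⇒0<n∸m p<n ∷ []) ,
  trans (cong (p +_) (+-identityʳ (n ∸ p))) (m+[n∸m]≡n (<⇒≤ p<n)) ,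
  s≤s (s≤s z≤n)

Large-∩-Homog : (n : ℕ) {k : ℕ} (f : List ℕ → Fin k) (φ : ℕ → ℕ)
  (L : List ℕ → Set) → Large n f φ L →
  (t₀ : Comp n) (s : ℕ) (h : List ℕ → Fin s) →
  Large n f φ (λ Z → L Z × Homog (firstC t₀) h Z)
Large-∩-Homog n f φ L large t₀ s h m palette
  with large m (λ t → palette t * s)
... | w , select = w , λ ρ →
  let (Y , sorted , bounded , inL , big , homf , homρh) =
        select (λ t A → combine (ρ t A) (h A))
  in Y , sorted , bounded ,
     (λ Z Z⊆Y lenZ → inL Z Z⊆Y lenZ , Homog-⊆ Z⊆Y (Homog-combineʳ {a = palette t₀} (homρh t₀))) ,
     big , homf , (λ t → Homog-combineˡ {a = palette t} (homρh t))

Large-∩-Homog-zero : (n : ℕ) {k : ℕ} (f : List ℕ → Fin k) (φ : ℕ → ℕ)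
  (L : List ℕ → Set) → Large n f φ L → {C : Set} (h : List ℕ → C) →
  Large n f φ (λ Z → L Z × Homog 0 h Z)
Large-∩-Homog-zero n f φ L large h m palette with large m palette
... | w , select = w , λ ρ →
  let (Y , sorted , bounded , inL , rest) = select ρ
  in Y , sorted , bounded , (λ Z Z⊆Y lenZ → inL Z Z⊆Y lenZ , Homog-zero h Z) , rest

lemma4p8 : (n k : ℕ) → 1 ≤ n → (f : List ℕ → Fin k) → (φ : ℕ → ℕ) →
    (∀ w → Arrow w (φ w) n (suc k)) → LiminfInfinite φ →
    (L : List ℕ → Set) → Large n f φ L →
    (p : ℕ) → p ≤ n ∸ 1 → (s : ℕ) → (h : List ℕ → Fin s) →
    Large n f φ (λ Z → L Z × Homog p h Z)
lemma4p8 n k _ f φ _ _ L large zero _ s h = Large-∩-Homog-zero n f φ L large h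
lemma4p8 (suc n) k _ f φ _ _ L large (suc p) p≤n s h =
  Large-∩-Homog (suc n) f φ L large (twoPartComp (suc n) (suc p) (s≤s z≤n) (s≤s p≤n)) s h
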